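{- Let $n$ be a positive integer and $g$ a function from nonnegative integers to integers. Suppose that $\mathrm{Span}(G,H) \leq g(\Delta(H))$ for all pairs of finite simple graphs $(G,H)$ with $H \subseteq G$, $|V(G)| = n$ and $\Delta(G) \leq \Delta(H)^2$. Then $\lambda_{2,1}(G) \leq g(\Delta(G))$ for every finite simple graph $G$ of order $n$.
   Context: $\Delta(\cdot)$ denotes maximum degree. For a graph $G$ and a subgraph $H \subseteq G$, a $(G,H)$-labeling with span at most $t$ is a function $\phi: V(G) \to \{0,1,\dots,t\}$ with $|\phi(u)-\phi(v)| \geq 2$ for $uv \in E(H)$ and $|\phi(u)-\phi(v)| \geq 1$ for $uv \in E(G)\setminus E(H)$; $\mathrm{Span}(G,H)$ is the least such $t$. An $L(2,1)$-labeling of a graph $G$ is a function $f: V(G)\to\mathbb{Z}$ such that $|f(x)-f(y)|\geq 2$ whenever $xy \in E(G)$ and $|f(x)-f(y)| \geq 1$ whenever the distance between $x$ and $y$ in $G$ is $2$. $\lambda_{2,1}(G)$ is the minimum, over all $L(2,1)$-labelings $f$ of $G$, of the difference between the largest and smallest label used. -}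

module Defs where

open import Data.Nat using (ℕ; _⊔_; _≤_)
open import Data.Integer as ℤ using (ℤ; +_; _-_)
open import Data.Bool using (Bool; true; false; if_then_else_)
open import Data.Fin using (Fin)
open import Data.List using (List; map; foldr; allFin)
open import Data.Nat.ListAction using (sum)
open import Data.Product using (Σ; ∃; _×_)
open import Relation.Binary.PropositionalEquality using (_≡_; _≢_)
open import Relation.Nullary using (¬_)

record Graph (n : ℕ) : Set where
  field
    adj    : Fin n → Fin n → Bool
    sym    : ∀ i j → adj i j ≡ adj j i
    irrefl : ∀ i → adj i i ≡ false
open Graph public

Edge : ∀ {n} → Graph n → Fin n → Fin n → Set
Edge G i j = adj G i j ≡ true

_⊆G_ : ∀ {n} → Graph n → Graph n → Set
H ⊆G G = ∀ i j → Edge H i j → Edge G i j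

degree : ∀ {n} → Graph n → Fin n → ℕ
degree {n} G v = sum (map (λ j → if adj G v j then 1 else 0) (allFin n))

-- maximum degree Δ(G) (0 for the empty vertex set)
Δ : ∀ {n} → Graph n → ℕ
Δ {n} G = foldr _⊔_ 0 (map (degree G) (allFin n))

Sep : ℕ → ℕ → ℕ → Set
Sep k a b = k ≤ ℤ.∣ + a - + b ∣

IsGHLabeling : ∀ {n} → Graph n → Graph n → ℕ → (Fin n → ℕ) → Set
IsGHLabeling {n} G H t φ =
  (∀ v → φ v ≤ t) ×
  (∀ u v → Edge H u v → Sep 2 (φ u) (φ v)) ×
  (∀ u v → Edge G u v → ¬ Edge H u v → Sep 1 (φ u) (φ v))

-- Span(G,H) ≤ x  (x an integer): there is a (G,H)-labeling of span at most t
-- for some t with t ≤ x  (equivalently, the least such t is ≤ x)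
SpanAtMost : ∀ {n} → Graph n → Graph n → ℤ → Set
SpanAtMost {n} G H x =
  Σ ℕ λ t → (+ t ℤ.≤ x) × ∃ λ (φ : Fin n → ℕ) → IsGHLabeling G H t φ

Dist2 : ∀ {n} → Graph n → Fin n → Fin n → Set
Dist2 G x y = x ≢ y × ¬ Edge G x y × ∃ λ z → Edge G x z × Edge G z y

IsL21 : ∀ {n} → Graph n → (Fin n → ℤ) → Set
IsL21 G f =
  (∀ x y → Edge G x y → 2 ≤ ℤ.∣ f x - f y ∣) ×
  (∀ x y → Dist2 G x y → 1 ≤ ℤ.∣ f x - f y ∣)

λ21AtMost : ∀ {n} → Graph n → ℤ → Set
λ21AtMost {n} G x =
  ∃ λ (f : Fin n → ℤ) → IsL21 G f × (∀ u v → f u - f v ℤ.≤ x)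

module Submission where

-- Given a graph G, let G² be its square: x and y are adjacent in G² when
-- they are adjacent in G or at distance 2 in G.  Then G ⊆ G², and a
-- (G², G)-labeling is exactly a labeling that separates G-neighbours by 2
-- and vertices at distance 2 by 1, i.e. an L(2,1)-labeling of G with the
-- same span.  Hence the hypothesis, applied to the pair (G², G), gives
-- λ_{2,1}(G) ≤ g(Δ(G)) as soon as Δ(G²) ≤ Δ(G)².

open import Defs
open import Data.Nat using (ℕ; _≤_; _<_; _^_)
open import Data.Integer using (ℤ)

open import Data.Nat using (zero; suc; _+_; _*_; _⊔_; z≤n; s≤s)
open import Data.Nat.Properties
  using ( ≤-refl; ≤-trans; +-mono-≤; +-mono-<-≤; +-mono-≤-<; *-monoˡ-≤
        ; *-identityʳ; +-identityʳ; m≤m+n; m≤n+m; m≤m⊔n; m≤n⊔m; ⊔-lub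
        ; +-0-commutativeMonoid; +-*-semiring; module ≤-Reasoning )
import Data.Integer as ℤ
import Data.Integer.Properties as ℤ
open import Data.Bool using (Bool; true; false; if_then_else_; _∧_; not)
import Data.Bool.Properties as Bool
open import Data.Fin using (Fin; _≟_) renaming (zero to fzero; suc to fsuc)
open import Data.Fin.Properties using (any?)
open import Data.List using (map; allFin; tabulate)
open import Data.List.Properties using (map-tabulate; foldr-preservesᵇ; foldr-preservesᵒ)
import Data.List.Relation.Unary.All.Properties as All
import Data.List.Relation.Unary.Any.Properties as Any
open import Data.Nat.ListAction using () renaming (sum to sumList)
open import Data.Product using (_,_)
open import Data.Sum using (_⊎_; inj₁; inj₂; [_,_])
open import Function using (_∘_; id; mk⇔)
open import Relation.Binary.PropositionalEquality
  using (_≡_; _≢_; refl; trans; cong; subst)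
  renaming (sym to ≡-sym)
open import Relation.Nullary using (¬_; Dec; yes; no; does; ¬?; _×-dec_; _⊎-dec_)
open import Relation.Nullary.Decidable using (dec-true; dec-false; does-⇔)

open import Algebra.Properties.CommutativeMonoid.Sum +-0-commutativeMonoid
  using (sum; ∑-distrib-+; ∑-comm; sum-cong-≗)
open import Algebra.Properties.Semiring.Sum +-*-semiring
  using (*-distribˡ-sum; *-distribʳ-sum)

sumList-allFin : ∀ {n} (f : Fin n → ℕ) → sumList (map f (allFin n)) ≡ sum f
sumList-allFin f = trans (cong sumList (map-tabulate id f)) (sumList-tabulate f)
  where
  sumList-tabulate : ∀ {m} (h : Fin m → ℕ) → sumList (tabulate h) ≡ sum h
  sumList-tabulate {zero}  h = refl
  sumList-tabulate {suc m} h = cong (h fzero +_) (sumList-tabulate (h ∘ fsuc))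

sum-mono : ∀ {n} (f h : Fin n → ℕ) → (∀ j → f j ≤ h j) → sum f ≤ sum h
sum-mono {zero}  f h f≤h = z≤n
sum-mono {suc n} f h f≤h = +-mono-≤ (f≤h fzero) (sum-mono (f ∘ fsuc) (h ∘ fsuc) (f≤h ∘ fsuc))

sum-mono-< : ∀ {n} (f h : Fin n → ℕ) → (∀ j → f j ≤ h j) → ∀ v → f v < h v → sum f < sum h
sum-mono-< f h f≤h fzero    fv<hv = +-mono-<-≤ fv<hv (sum-mono (f ∘ fsuc) (h ∘ fsuc) (f≤h ∘ fsuc))
sum-mono-< f h f≤h (fsuc v) fv<hv =
  +-mono-≤-< (f≤h fzero) (sum-mono-< (f ∘ fsuc) (h ∘ fsuc) (f≤h ∘ fsuc) v fv<hv)

summand≤sum : ∀ {n} (f : Fin n → ℕ) v → f v ≤ sum f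
summand≤sum f fzero    = m≤m+n (f fzero) _
summand≤sum f (fsuc v) = ≤-trans (summand≤sum (f ∘ fsuc) v) (m≤n+m _ (f fzero))

⟦_⟧ : Bool → ℕ
⟦ b ⟧ = if b then 1 else 0

degree-∑ : ∀ {n} (G : Graph n) v → degree G v ≡ sum (λ j → ⟦ adj G v j ⟧)
degree-∑ G v = sumList-allFin (λ j → ⟦ adj G v j ⟧)

degree≤Δ : ∀ {n} (G : Graph n) v → degree G v ≤ Δ G
degree≤Δ G v rewrite map-tabulate id (degree G) =
  foldr-preservesᵒ max-keeps-lower-bound 0 _ (inj₂ (Any.tabulate⁺ v ≤-refl))
  where
  max-keeps-lower-bound : ∀ x y → degree G v ≤ x ⊎ degree G v ≤ y → degree G v ≤ x ⊔ y
  max-keeps-lower-bound x y = [ (λ p → ≤-trans p (m≤m⊔n x y)) , (λ p → ≤-trans p (m≤n⊔m x y)) ]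

Δ-least : ∀ {n} (G : Graph n) c → (∀ v → degree G v ≤ c) → Δ G ≤ c
Δ-least G c deg≤c rewrite map-tabulate id (degree G) =
  foldr-preservesᵇ {P = _≤ c} ⊔-lub z≤n (All.tabulate⁺ deg≤c)

module Square {n : ℕ} (G : Graph n) where

  edge? : ∀ x y → Dec (Edge G x y)
  edge? x y = adj G x y Bool.≟ true

  dist2? : ∀ x y → Dec (Dist2 G x y)
  dist2? x y = ¬? (x ≟ y) ×-dec ¬? (edge? x y) ×-dec any? (λ z → edge? x z ×-dec edge? z y)

  edge-sym : ∀ {x y} → Edge G x y → Edge G y x
  edge-sym {x} {y} e = trans (Graph.sym G y x) e

  dist2-sym : ∀ {x y} → Dist2 G x y → Dist2 G y x
  dist2-sym (x≢y , ¬xy , z , xz , zy) = x≢y ∘ ≡-sym , ¬xy ∘ edge-sym , z , edge-sym zy , edge-sym xz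

  Edge² : Fin n → Fin n → Set
  Edge² x y = Edge G x y ⊎ Dist2 G x y

  edge²? : ∀ x y → Dec (Edge² x y)
  edge²? x y = edge? x y ⊎-dec dist2? x y

  edge²-sym : ∀ {x y} → Edge² x y → Edge² y x
  edge²-sym = [ inj₁ ∘ edge-sym , inj₂ ∘ dist2-sym ]

  edge²-irrefl : ∀ x → ¬ Edge² x x
  edge²-irrefl x (inj₁ e) with () ← trans (≡-sym e) (irrefl G x)
  edge²-irrefl x (inj₂ (x≢x , _)) = x≢x refl

  square : Graph n
  square = record
    { adj    = λ x y → does (edge²? x y)
    ; sym    = λ x y → does-⇔ (mk⇔ edge²-sym edge²-sym) (edge²? x y) (edge²? y x)
    ; irrefl = λ x → dec-false (edge²? x x) (edge²-irrefl x)
    }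

  G⊆square : G ⊆G square
  G⊆square x y e = dec-true (edge²? x y) (inj₁ e)

  dist2⇒square : ∀ x y → Dist2 G x y → Edge square x y
  dist2⇒square x y d = dec-true (edge²? x y) (inj₂ d)

  -- beyond v z j = ⟦ j is a G-neighbour of z other than v ⟧; such j reach
  -- v in two steps through z.
  beyond : Fin n → Fin n → Fin n → ℕ
  beyond v z j = ⟦ adj G z j ∧ not (does (j ≟ v)) ⟧

  beyond≤adj : ∀ v z j → beyond v z j ≤ ⟦ adj G z j ⟧
  beyond≤adj v z j with adj G z j | does (j ≟ v)
  ... | false | _     = z≤n
  ... | true  | true  = z≤n
  ... | true  | false = ≤-refl

  beyond-self : ∀ v z → beyond v z v ≡ 0
  beyond-self v z rewrite dec-true (v ≟ v) refl | Bool.∧-zeroʳ (adj G z v) = refl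

  beyond-hit : ∀ v z j → Edge G z j → v ≢ j → beyond v z j ≡ 1
  beyond-hit v z j zj v≢j rewrite zj | dec-false (j ≟ v) (v≢j ∘ ≡-sym) = refl

  beyond-sum<Δ : ∀ v z → Edge G v z → sum (beyond v z) < Δ G
  beyond-sum<Δ v z vz = begin-strict
    sum (beyond v z)                 <⟨ sum-mono-< (beyond v z) _ (beyond≤adj v z) v beyond<adj ⟩
    sum (λ j → ⟦ adj G z j ⟧)        ≡⟨ degree-∑ G z ⟨
    degree G z                       ≤⟨ degree≤Δ G z ⟩
    Δ G                              ∎
    where
    open ≤-Reasoning
    beyond<adj : beyond v z v < ⟦ adj G z v ⟧
    beyond<adj rewrite beyond-self v z | edge-sym vz = s≤s z≤n

  square-count : ∀ v j →
    ⟦ adj square v j ⟧ ≤ ⟦ adj G v j ⟧ + sum (λ z → ⟦ adj G v z ⟧ * beyond v z j)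
  square-count v j = count (edge²? v j)
    where
    paths : Fin n → ℕ
    paths z = ⟦ adj G v z ⟧ * beyond v z j

    count : (e? : Dec (Edge² v j)) → ⟦ does e? ⟧ ≤ ⟦ adj G v j ⟧ + sum paths
    count (no _) = z≤n
    count (yes (inj₁ vj)) rewrite vj = s≤s z≤n
    count (yes (inj₂ (v≢j , _ , z , vz , zj))) =
      ≤-trans (subst (_≤ sum paths) path-through-z (summand≤sum paths z)) (m≤n+m _ ⟦ adj G v j ⟧)
      where
      path-through-z : paths z ≡ 1
      path-through-z rewrite vz | beyond-hit v z j zj v≢j = refl

  -- A neighbour z of v contributes itself plus its neighbours beyond v,
  -- at most Δ(G) vertices in total.
  neighbour-weight : ∀ v z → ⟦ adj G v z ⟧ + ⟦ adj G v z ⟧ * sum (beyond v z) ≤ ⟦ adj G v z ⟧ * Δ G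
  neighbour-weight v z with adj G v z in vz
  ... | false = z≤n
  ... | true  rewrite +-identityʳ (sum (beyond v z)) | +-identityʳ (Δ G) = beyond-sum<Δ v z vz

  -- Counting G²-neighbours of v through the G-neighbours of v.
  degree-square : ∀ v → degree square v ≤ Δ G ^ 2
  degree-square v = begin
    degree square v                                             ≡⟨ degree-∑ square v ⟩
    sum (λ j → ⟦ adj square v j ⟧)                              ≤⟨ sum-mono _ _ (square-count v) ⟩
    sum (λ j → a j + sum (λ z → a z * beyond v z j))            ≡⟨ ∑-distrib-+ a _ ⟩
    sum a + sum (λ j → sum (λ z → a z * beyond v z j))          ≡⟨ cong (sum a +_) (∑-comm (λ j z → a z * beyond v z j)) ⟩
    sum a + sum (λ z → sum (λ j → a z * beyond v z j))          ≡⟨ cong (sum a +_) (sum-cong-≗ λ z → *-distribˡ-sum (a z) (beyond v z)) ⟨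
    sum a + sum (λ z → a z * sum (beyond v z))                  ≡⟨ ∑-distrib-+ a _ ⟨
    sum (λ z → a z + a z * sum (beyond v z))                    ≤⟨ sum-mono _ _ (neighbour-weight v) ⟩
    sum (λ z → a z * Δ G)                                       ≡⟨ *-distribʳ-sum (Δ G) a ⟨
    sum a * Δ G                                                 ≡⟨ cong (_* Δ G) (degree-∑ G v) ⟨
    degree G v * Δ G                                            ≤⟨ *-monoˡ-≤ (Δ G) (degree≤Δ G v) ⟩
    Δ G * Δ G                                                   ≡⟨ cong (Δ G *_) (*-identityʳ (Δ G)) ⟨
    Δ G ^ 2                                                     ∎
    where
    open ≤-Reasoning
    a : Fin n → ℕ
    a z = ⟦ adj G v z ⟧

  Δ-square : Δ square ≤ Δ G ^ 2
  Δ-square = Δ-least square (Δ G ^ 2) degree-square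

  labeling⇒L21 : ∀ {t φ} → IsGHLabeling square G t φ → IsL21 G (ℤ.+_ ∘ φ)
  labeling⇒L21 (_ , sep-G , sep-square) =
    sep-G , λ x y d@(_ , ¬xy , _) → sep-square x y (dist2⇒square x y d) ¬xy

open Square using (square; G⊆square; Δ-square; labeling⇒L21)

label-differences : ∀ {n} (φ : Fin n → ℕ) {t : ℕ} {x : ℤ} →
  (∀ v → φ v ≤ t) → ℤ.+ t ℤ.≤ x → ∀ u v → ℤ.+ φ u ℤ.- ℤ.+ φ v ℤ.≤ x
label-differences φ φ≤t t≤x u v = ℤ.i≤j⇒i-k≤j (ℤ.+ φ v) (ℤ.≤-trans (ℤ.+≤+ (φ≤t u)) t≤x)

mainTheorem2 : (n : ℕ) → 0 < n → (g : ℕ → ℤ)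
    → (∀ (G H : Graph n) → H ⊆G G → Δ G ≤ Δ H ^ 2 → SpanAtMost G H (g (Δ H)))
    → ∀ (G : Graph n) → λ21AtMost G (g (Δ G))
mainTheorem2 n _ g span-bound G
  with span-bound (square G) G (G⊆square G) (Δ-square G)
... | t , t≤g , φ , labeling@(φ≤t , _) =
  ℤ.+_ ∘ φ , labeling⇒L21 G labeling , label-differences φ φ≤t t≤g
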